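{- Let $G$ be a graph and $u,v\in V(G)$. Then: (1) $B_u\cap B_v\neq\emptyset$ iff $u\in N[v]$ iff $v\in N[u]$. (2) $B_u\subseteq B_v$ iff $N[u]\subseteq N[v]$. (3) If $u$ and $v$ are adjacent, then $B_u\cup B_v=\mathcal{C}(G)$ iff all of the following hold: (a) $N[u]\cup N[v]=V(G)$; (b) every $w\in N[u]\setminus N[v]$ satisfies $N[w]\subseteq N[u]$; (c) every $w\in N[v]\setminus N[u]$ satisfies $N[w]\subseteq N[v]$. (4) If $u$ and $v$ are adjacent, then for every $w\in V(G)$: $B_u\cap B_v\subseteq B_w$ iff $N[u]\cap N[v]\subseteq N[w]$.
   Context: $N[v]$ denotes the closed neighborhood of $v$ (i.e. $v$ together with all its neighbors). A maxclique is an inclusion-maximal clique; $\mathcal{C}(G)$ is the set of all maxcliques of $G$. For a vertex $v$, its bundle $B_v$ is the set of all maxcliques of $G$ containing $v$. -}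

module Defs where

open import Level using (0ℓ)
open import Data.Nat using (ℕ)
open import Data.Fin using (Fin)
open import Data.Fin.Subset as S using (Subset)
open import Data.Sum using (_⊎_)
open import Data.Product using (_×_)
open import Relation.Nullary using (¬_)
open import Relation.Binary using (Decidable)
open import Relation.Binary.PropositionalEquality using (_≡_; _≢_)
open import Relation.Unary using (Pred)

record Graph (n : ℕ) : Set₁ where
  field
    Adj    : Fin n → Fin n → Set
    adj?   : Decidable Adj
    sym    : ∀ {x y} → Adj x y → Adj y x
    irrefl : ∀ {x} → ¬ Adj x x
open Graph public

module _ {n : ℕ} (G : Graph n) where

  N[_] : Fin n → Pred (Fin n) 0ℓ
  N[ v ] w = w ≡ v ⊎ Adj G v w

  IsClique : Subset n → Set
  IsClique C = ∀ x y → x S.∈ C → y S.∈ C → x ≢ y → Adj G x y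

  IsMaxClique : Subset n → Set
  IsMaxClique C = IsClique C × (∀ D → IsClique D → C S.⊆ D → D S.⊆ C)

  𝒞 : Pred (Subset n) 0ℓ
  𝒞 = IsMaxClique

  B : Fin n → Pred (Subset n) 0ℓ
  B v C = IsMaxClique C × v S.∈ C

module Submission where

-- Everything rests on one description of bundles: for a maxclique C,
--   v ∈ C   iff   C ⊆ N[v]
-- (left to right because C is a clique, right to left because C is maximal,
-- so it absorbs every vertex joined to all of its members).  The second
-- ingredient is that every clique extends to a maxclique (well-founded
-- recursion on strict supersets), so any vertex set that is pairwise joined
-- (an edge, a triangle) lies in a common maxclique.
--
-- With these, part (1) picks a maxclique through the edge uv; part (4) picks
-- one through the triangle u,v,x, and part (2) is the instance u = v of (4);
-- part (3) turns "every maxclique contains u or v" into the neighbourhood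
-- conditions by looking at maxcliques through a vertex and through an edge.
-- The adjacency of u and v is only needed in (4), and only as u ∈ N[v].

open import Defs
open import Data.Nat using (ℕ)
open import Data.Fin using (Fin; _≟_)
open import Data.Fin.Subset using (Subset)
open import Data.Product using (_×_; Σ-syntax; _,_; proj₁)
open import Function.Bundles using (_⇔_; mk⇔; module Equivalence)
open import Relation.Unary using (_∈_; _⊆_; _∩_; _∪_; _∖_; _≐_; Satisfiable)

import Data.Fin.Subset as S
open import Data.Fin.Subset.Properties
  using (_∈?_; x∈⁅x⁆; x∈⁅y⁆⇒x≡y; p⊆p∪q; q⊆p∪q; x∈p∪q⁻)
open import Data.Fin.Subset.Induction using (⊃-wellFounded)
open import Data.Fin.Properties using (any?; all?)
open import Induction.WellFounded using (Acc; acc)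
open import Data.Sum using (inj₁; inj₂; swap)
open import Data.Empty using (⊥-elim)
open import Relation.Nullary using (Dec; yes; no)
open import Relation.Nullary.Decidable using (¬?; _×-dec_; _→-dec_; _⊎-dec_)
open import Relation.Binary.PropositionalEquality using (refl; trans)
  renaming (sym to ≡-sym)
open import Function.Base using (_∘_)

module Bundles {n : ℕ} (G : Graph n) where

  N : Fin n → Fin n → Set
  N = N[_] G

  infix 4 _⊆N[_]
  _⊆N[_] : Subset n → Fin n → Set
  C ⊆N[ x ] = ∀ {z} → z S.∈ C → z ∈ N x

  N-sym : ∀ {u v} → u ∈ N v → v ∈ N u
  N-sym (inj₁ u≡v) = inj₁ (≡-sym u≡v)
  N-sym (inj₂ adj) = inj₂ (sym G adj)

  N? : ∀ u x → Dec (x ∈ N u)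
  N? u x = (x ≟ u) ⊎-dec adj? G u x

  ⊆N? : ∀ C x → Dec (C ⊆N[ x ])
  ⊆N? C x with all? (λ z → (z ∈? C) →-dec N? x z)
  ... | yes all = yes (λ {z} → all z)
  ... | no ¬all = no (λ h → ¬all (λ z → h {z}))

  clique-⊆N : ∀ {C x} → IsClique G C → x S.∈ C → C ⊆N[ x ]
  clique-⊆N {x = x} cl x∈C {z} z∈C with z ≟ x
  ... | yes z≡x = inj₁ z≡x
  ... | no z≢x = inj₂ (cl x z x∈C z∈C (λ x≡z → z≢x (≡-sym x≡z)))

  pairwise⇒clique : ∀ {C} → (∀ {x} → x S.∈ C → C ⊆N[ x ]) → IsClique G C
  pairwise⇒clique joined x y x∈C y∈C x≢y with joined x∈C y∈C
  ... | inj₁ y≡x = ⊥-elim (x≢y (≡-sym y≡x))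
  ... | inj₂ adj = adj

  singleton-clique : ∀ x → IsClique G S.⁅ x ⁆
  singleton-clique x y z y∈x z∈x y≢z =
    ⊥-elim (y≢z (trans (x∈⁅y⁆⇒x≡y x y∈x) (≡-sym (x∈⁅y⁆⇒x≡y x z∈x))))

  clique-insert : ∀ {C x} → IsClique G C → C ⊆N[ x ] → IsClique G (C S.∪ S.⁅ x ⁆)
  clique-insert {C} {x} cl C⊆Nx = pairwise⇒clique joined
    where
    joined : ∀ {y} → y S.∈ C S.∪ S.⁅ x ⁆ → C S.∪ S.⁅ x ⁆ ⊆N[ y ]
    joined {y} y∈ {z} z∈ with x∈p∪q⁻ C S.⁅ x ⁆ y∈ | x∈p∪q⁻ C S.⁅ x ⁆ z∈
    ... | inj₁ y∈C | inj₁ z∈C = clique-⊆N cl y∈C z∈C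
    ... | inj₁ y∈C | inj₂ z∈x rewrite x∈⁅y⁆⇒x≡y x z∈x = N-sym (C⊆Nx y∈C)
    ... | inj₂ y∈x | inj₁ z∈C rewrite x∈⁅y⁆⇒x≡y x y∈x = C⊆Nx z∈C
    ... | inj₂ y∈x | inj₂ z∈x rewrite x∈⁅y⁆⇒x≡y x y∈x | x∈⁅y⁆⇒x≡y x z∈x = inj₁ refl

  extend : ∀ C → Acc S._⊃_ C → IsClique G C →
           Σ[ M ∈ Subset n ] (IsMaxClique G M × C S.⊆ M)
  extend C (acc rec) cl with any? (λ x → ¬? (x ∈? C) ×-dec ⊆N? C x)
  ... | yes (x , x∉C , C⊆Nx) with extend (C S.∪ S.⁅ x ⁆)
          (rec (p⊆p∪q S.⁅ x ⁆ , x , q⊆p∪q C S.⁅ x ⁆ (x∈⁅x⁆ x) , x∉C))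
          (clique-insert cl C⊆Nx)
  ...   | M , maxM , C∪x⊆M = M , maxM , λ z∈C → C∪x⊆M (p⊆p∪q S.⁅ x ⁆ z∈C)
  extend C (acc _) cl | no ¬grow = C , (cl , maximal) , λ z∈C → z∈C
    where
    maximal : ∀ D → IsClique G D → C S.⊆ D → D S.⊆ C
    maximal D clD C⊆D {y} y∈D with y ∈? C
    ... | yes y∈C = y∈C
    ... | no y∉C = ⊥-elim (¬grow (y , y∉C , λ z∈C → clique-⊆N clD y∈D (C⊆D z∈C)))

  clique⇒maxclique : ∀ C → IsClique G C → Σ[ M ∈ Subset n ] (IsMaxClique G M × C S.⊆ M)
  clique⇒maxclique C = extend C (⊃-wellFounded C)

  maxclique-absorbs : ∀ {C u} → IsMaxClique G C → C ⊆N[ u ] → u S.∈ C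
  maxclique-absorbs {C} {u} (cl , maximal) C⊆Nu =
    maximal (C S.∪ S.⁅ u ⁆) (clique-insert cl C⊆Nu) (p⊆p∪q S.⁅ u ⁆)
            (q⊆p∪q C S.⁅ u ⁆ (x∈⁅x⁆ u))

  bundle-⊆N : ∀ {C v} → C ∈ B G v → C ⊆N[ v ]
  bundle-⊆N ((cl , _) , v∈C) = clique-⊆N cl v∈C

  ⊆N-bundle : ∀ {C v} → IsMaxClique G C → C ⊆N[ v ] → C ∈ B G v
  ⊆N-bundle maxC C⊆Nv = maxC , maxclique-absorbs maxC C⊆Nv

  triangle-maxclique : ∀ {u v x} → u ∈ N v → x ∈ N u → x ∈ N v →
    Σ[ M ∈ Subset n ] (M ∈ B G u × M ∈ B G v × M ∈ B G x)
  triangle-maxclique {u} {v} {x} u∈Nv x∈Nu x∈Nv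
    with clique⇒maxclique (uv S.∪ S.⁅ x ⁆) (clique-insert uv-clique uv⊆Nx)
    where
    uv : Subset n
    uv = S.⁅ u ⁆ S.∪ S.⁅ v ⁆
    uv-clique : IsClique G uv
    uv-clique = clique-insert (singleton-clique u) u⊆Nv
      where
      u⊆Nv : S.⁅ u ⁆ ⊆N[ v ]
      u⊆Nv z∈u rewrite x∈⁅y⁆⇒x≡y u z∈u = u∈Nv
    uv⊆Nx : uv ⊆N[ x ]
    uv⊆Nx z∈uv with x∈p∪q⁻ S.⁅ u ⁆ S.⁅ v ⁆ z∈uv
    ... | inj₁ z∈u rewrite x∈⁅y⁆⇒x≡y u z∈u = N-sym x∈Nu
    ... | inj₂ z∈v rewrite x∈⁅y⁆⇒x≡y v z∈v = N-sym x∈Nv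
  ... | M , maxM , ⊆M =
    M , (maxM , ⊆M (p⊆p∪q S.⁅ x ⁆ (p⊆p∪q S.⁅ v ⁆ (x∈⁅x⁆ u))))
      , (maxM , ⊆M (p⊆p∪q S.⁅ x ⁆ (q⊆p∪q S.⁅ u ⁆ S.⁅ v ⁆ (x∈⁅x⁆ v))))
      , (maxM , ⊆M (q⊆p∪q (S.⁅ u ⁆ S.∪ S.⁅ v ⁆) S.⁅ x ⁆ (x∈⁅x⁆ x)))

  edge-maxclique : ∀ {u v} → u ∈ N v → Σ[ M ∈ Subset n ] (M ∈ B G u × M ∈ B G v)
  edge-maxclique u∈Nv with triangle-maxclique u∈Nv (N-sym u∈Nv) (inj₁ refl)
  ... | M , Mu , Mv , _ = M , Mu , Mv

  bundles-meet⇔ : ∀ {u v} → Satisfiable (B G u ∩ B G v) ⇔ u ∈ N v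
  bundles-meet⇔ = mk⇔ (λ { (C , (_ , u∈C) , C∈Bv) → bundle-⊆N C∈Bv u∈C })
                      edge-maxclique

  bundle-meet-⊆⇔ : ∀ {u v w} → u ∈ N v →
    (B G u ∩ B G v) ⊆ B G w ⇔ (N u ∩ N v) ⊆ N w
  bundle-meet-⊆⇔ {u} {v} {w} u∈Nv = mk⇔ to from
    where
    -- a maxclique through the triangle u, v, x lies in B_w, so x ∈ N[w]
    to : (B G u ∩ B G v) ⊆ B G w → (N u ∩ N v) ⊆ N w
    to B∩⊆Bw (x∈Nu , x∈Nv) with triangle-maxclique u∈Nv x∈Nu x∈Nv
    ... | M , M∈Bu , M∈Bv , (_ , x∈M) = bundle-⊆N (B∩⊆Bw (M∈Bu , M∈Bv)) x∈M

    from : (N u ∩ N v) ⊆ N w → (B G u ∩ B G v) ⊆ B G w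
    from N∩⊆Nw (C∈Bu , C∈Bv) =
      ⊆N-bundle (proj₁ C∈Bu) (λ z∈C → N∩⊆Nw (bundle-⊆N C∈Bu z∈C , bundle-⊆N C∈Bv z∈C))

  -- Part (2) is the case u = v of part (4).
  bundle-⊆⇔ : ∀ {u v} → B G u ⊆ B G v ⇔ N u ⊆ N v
  bundle-⊆⇔ {u} {v} = mk⇔ to′ from′
    where
    open Equivalence (bundle-meet-⊆⇔ {u} {u} {v} (inj₁ refl))
    to′ : B G u ⊆ B G v → N u ⊆ N v
    to′ Bu⊆Bv x∈Nu = to (λ (C∈Bu , _) → Bu⊆Bv C∈Bu) (x∈Nu , x∈Nu)
    from′ : N u ⊆ N v → B G u ⊆ B G v
    from′ Nu⊆Nv C∈Bu = from (λ (x∈Nu , _) → Nu⊆Nv x∈Nu) (C∈Bu , C∈Bu)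

  -- Part (3).  If every maxclique contains u or v, then every vertex is joined
  -- to u or v (look at a maxclique through it) ...
  cover⇒dominating : ∀ {u v} → 𝒞 G ⊆ (B G u ∪ B G v) → ∀ w → w ∈ (N u ∪ N v)
  cover⇒dominating cover w with edge-maxclique {w} {w} (inj₁ refl)
  ... | M , (maxM , w∈M) , _ with cover maxM
  ...   | inj₁ M∈Bu = inj₁ (bundle-⊆N M∈Bu w∈M)
  ...   | inj₂ M∈Bv = inj₂ (bundle-⊆N M∈Bv w∈M)

  -- ... and a vertex w joined to u but not to v has N[w] ⊆ N[u]: a maxclique
  -- through an edge wx cannot contain v, so it contains u.
  cover⇒private : ∀ {u v} → 𝒞 G ⊆ (B G u ∪ B G v) →
    ∀ w → w ∈ (N u ∖ N v) → N w ⊆ N u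
  cover⇒private cover w (_ , w∉Nv) x∈Nw with edge-maxclique x∈Nw
  ... | M , (maxM , x∈M) , (_ , w∈M) with cover maxM
  ...   | inj₁ M∈Bu = bundle-⊆N M∈Bu x∈M
  ...   | inj₂ M∈Bv = ⊥-elim (w∉Nv (bundle-⊆N M∈Bv w∈M))

  -- Conversely, a maxclique C avoiding v is contained in N[u]: a member x of C
  -- outside N[u] lies in N[v] ∖ N[u], so C ⊆ N[x] ⊆ N[v] and v ∈ C.
  private⇒cover : ∀ {u v} → (∀ w → w ∈ (N u ∪ N v)) →
    (∀ w → w ∈ (N v ∖ N u) → N w ⊆ N v) → 𝒞 G ⊆ (B G u ∪ B G v)
  private⇒cover {u} {v} dominating v-private {C} maxC with v ∈? C
  ... | yes v∈C = inj₂ (maxC , v∈C)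
  ... | no v∉C = inj₁ (⊆N-bundle maxC C⊆Nu)
    where
    C⊆Nu : C ⊆N[ u ]
    C⊆Nu {x} x∈C with N? u x | dominating x
    ... | yes x∈Nu | _ = x∈Nu
    ... | no x∉Nu | inj₁ x∈Nu = ⊥-elim (x∉Nu x∈Nu)
    ... | no x∉Nu | inj₂ x∈Nv = ⊥-elim (v∉C (maxclique-absorbs maxC
            (λ z∈C → v-private x (x∈Nv , x∉Nu) (clique-⊆N (proj₁ maxC) x∈C z∈C))))

  bundles-cover⇔ : ∀ {u v} → (B G u ∪ B G v) ≐ 𝒞 G ⇔
    ((∀ w → w ∈ (N u ∪ N v))
     × (∀ w → w ∈ (N u ∖ N v) → N w ⊆ N u)
     × (∀ w → w ∈ (N v ∖ N u) → N w ⊆ N v))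
  bundles-cover⇔ {u} {v} = mk⇔
    (λ (_ , cover) → cover⇒dominating cover
                   , cover⇒private cover
                   , cover⇒private (swap ∘ cover))
    (λ (dominating , _ , v-private) → bundle-maxclique , private⇒cover dominating v-private)
    where
    bundle-maxclique : (B G u ∪ B G v) ⊆ 𝒞 G
    bundle-maxclique (inj₁ (maxC , _)) = maxC
    bundle-maxclique (inj₂ (maxC , _)) = maxC

open Bundles

lemma5 : ∀ {n : ℕ} (G : Graph n) (u v : Fin n) →
    ((Satisfiable (B G u ∩ B G v) ⇔ u ∈ N[_] G v) × (u ∈ N[_] G v ⇔ v ∈ N[_] G u))
    × ((B G u ⊆ B G v) ⇔ (N[_] G u ⊆ N[_] G v))
    × (Adj G u v →
        ((B G u ∪ B G v) ≐ 𝒞 G) ⇔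
          ((∀ w → w ∈ (N[_] G u ∪ N[_] G v))
           × (∀ w → w ∈ (N[_] G u ∖ N[_] G v) → N[_] G w ⊆ N[_] G u)
           × (∀ w → w ∈ (N[_] G v ∖ N[_] G u) → N[_] G w ⊆ N[_] G v)))
    × (Adj G u v → ∀ (w : Fin n) →
        ((B G u ∩ B G v) ⊆ B G w) ⇔ ((N[_] G u ∩ N[_] G v) ⊆ N[_] G w))
lemma5 G u v =
    (bundles-meet⇔ G , mk⇔ (N-sym G) (N-sym G))
  , bundle-⊆⇔ G
  , (λ _ → bundles-cover⇔ G)
  , (λ u~v w → bundle-meet-⊆⇔ G {w = w} (N-sym G (inj₂ u~v)))
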